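{- Fix $n\ge1$, and for $k\in\{1,\dots,n\}$ let $b_k=b_{n,k}$, so that for all $m\ge n$ $$c_{n,m}(1)=\sum_{k=1}^{n} b_k\binom{m-1}{k-1}.$$ Then: (a) $b_k$ is a positive integer for all $k\in\{1,\dots,n\}$; (b) $b_1=1$; (c) $b_2=\binom{n}{\lfloor n/2\rfloor}-1$; (d) $b_n=1$.
   Context: Words are finite sequences of positive integers; $|w|$ is the length of $w$. $P(w)$ is the insertion tableau of $w$ under the Robinson–Schensted–Knuth (row-insertion) correspondence, and $C(u)=\{w : P(uw)=P(wu)\}$ (juxtaposition is concatenation). $c_{n,m}(u)=\#\{w\in C(u): |w|=n,\ \max w\le m\}$. A word $w$ is $k$-packed if $\max w=k$ and every element of $\{1,\dots,k\}$ occurs in $w$. $b_{n,k}$ is the number of $k$-packed words $w\in C(1)$ with $|w|=n$. -}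

module Defs where

open import Data.Nat using (ℕ; zero; suc; _<?_)
open import Data.Nat.Properties using (_≟_)
open import Data.List using (List; []; _∷_; [_]; _++_; foldl; map; concatMap; upTo; length; filter)
open import Data.List.Properties using (≡-dec)
open import Data.List.Relation.Unary.All using (All)
open import Data.List.Relation.Unary.All using (all?) renaming ()
open import Data.List.Membership.DecPropositional _≟_ using (_∈_; _∈?_)
open import Data.Maybe using (Maybe; just; nothing)
open import Data.Product using (_×_; _,_)
open import Relation.Binary.PropositionalEquality using (_≡_)
open import Relation.Nullary using (Dec; yes; no)
open import Relation.Nullary.Decidable using (_×-dec_)

-- Words: lists of positive integers (letters are ℕ; all words we enumerate use letters ≥ 1).
Word : Set
Word = List ℕ

-- A tableau is a list of rows (top row first), each row a weakly increasing list.
Tableau : Set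
Tableau = List (List ℕ)

insertRow : ℕ → List ℕ → List ℕ × Maybe ℕ
insertRow x [] = [ x ] , nothing
insertRow x (y ∷ ys) with x <? y
... | yes _ = x ∷ ys , just y
... | no _ with insertRow x ys
...   | r , b = y ∷ r , b

insertT : ℕ → Tableau → Tableau
insertT x [] = [ [ x ] ] 
insertT x (r ∷ rs) with insertRow x r
... | r' , nothing = r' ∷ rs
... | r' , just y  = r' ∷ insertT y rs

P : Word → Tableau
P w = foldl (λ T x → insertT x T) [] w

-- w ∈ C(u)  iff  P(uw) = P(wu).
InC : Word → Word → Set
InC u w = P (u ++ w) ≡ P (w ++ u)

InC? : (u w : Word) → Dec (InC u w)
InC? u w = ≡-dec (≡-dec _≟_) (P (u ++ w)) (P (w ++ u))

letters : ℕ → List ℕ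
letters k = map suc (upTo k)

words : ℕ → ℕ → List Word
words zero k = [ [] ]
words (suc n) k = concatMap (λ w → map (λ i → i ∷ w) (letters k)) (words n k)

-- w is k-packed: every element of {1,…,k} occurs in w (for w ∈ words n k this gives max w = k).
Packed : ℕ → Word → Set
Packed k w = All (λ i → i ∈ w) (letters k)

Packed? : (k : ℕ) (w : Word) → Dec (Packed k w)
Packed? k w = all? (λ i → i ∈? w) (letters k)

b : ℕ → ℕ → ℕ
b n k = length (filter (λ w → Packed? k w ×-dec InC? [ 1 ] w) (words n k))

{-# OPTIONS --safe #-}
module Submission where

-- Inserting the letter 1 in front of a word w whose letters are all ≥ 1 only
-- prepends 1 to the first row of P(w), whereas inserting it at the end bumps the
-- leftmost entry > 1 of that row, if there is one.  Hence w ∈ C(1) iff the first row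
-- of P(w) contains only 1s.
--  (a) For k(k-1)⋯21 1ⁿ⁻ᵏ the first row is 1ⁿ⁻ᵏ⁺¹.  (b) 1ⁿ is the only 1-packed word.
--  (d) An n-packed word of length n has a single 1, so its first row has length 1,
--      which forces it to be strictly decreasing, i.e. n(n-1)⋯1.
--  (c) For words over {1,2} the number of 2s in the first row is the bracket depth of w
--      read with 2 = "(" and 1 = ")", so w ∈ C(1) iff every 2 is closed by a later 1.
--      Such words with at most j letters 2 satisfy Pascal's rule and number C(n,j)
--      for 2j ≤ n; all of them have at most ⌊n/2⌋ letters 2, and only 1ⁿ has none.

open import Defs
open import Data.Bool using (true; false)
open import Data.List using (List; []; _∷_; [_]; _++_; length; filter; foldl; map; replicate; applyUpTo; concatMap; cartesianProductWith)
open import Data.List.Membership.Propositional using (_∈_; _∉_; lose)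
open import Data.List.Membership.Propositional.Properties using (∈-∃++; ∈-++⁻; ∈-++⁺ˡ; ∈-++⁺ʳ; ∈-filter⁺; ∈-filter⁻; ∈-map⁺; ∈-map⁻; ∈-upTo⁺; ∈-upTo⁻; ∈-applyUpTo⁻; ∈-cartesianProductWith⁺; ∈-cartesianProductWith⁻)
open import Data.List.Properties using (length-++; length-map; length-applyUpTo; length-replicate; filter-++; filter-accept; filter-reject; filter-all; filter-none; filter-some; ++-assoc; ++-identityʳ; foldl-++; ∷-injective)
open import Data.List.Relation.Binary.Subset.Propositional using (_⊆_)
open import Data.List.Relation.Unary.All as All using (All; []; _∷_)
open import Data.List.Relation.Unary.All.Properties using (¬Any⇒All¬; ++⁺; replicate⁺)
open import Data.List.Relation.Unary.Any using (Any; here; there)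
open import Data.List.Relation.Unary.Linked as Linked using (Linked; []; [-]; _∷_)
open import Data.List.Relation.Unary.Linked.Properties using (Linked⇒All)
open import Data.List.Relation.Unary.Unique.Propositional using (Unique; []; _∷_)
import Data.List.Relation.Unary.Unique.Propositional.Properties as Unique
open import Data.Maybe using (Maybe; just; nothing; maybe′)
open import Data.Nat using (ℕ; zero; suc; _+_; _*_; _∸_; _/_; _≤_; _<_; _>_; z≤n; s≤s; _<?_; _≤?_)
open import Data.Nat.Combinatorics using (_C_; nCk≡nC[n∸k]; nCk+nC[k+1]≡[n+1]C[k+1])
open import Data.Nat.DivMod using (m/n*n≤m; m*n/n≡m; /-monoˡ-≤)
open import Data.Nat.Properties using (_≟_; +-suc; +-comm; +-identityʳ; *-comm; +-mono-≤; +-monoˡ-<; +-monoʳ-≤; +-cancelʳ-≤; suc-injective; 1+n≢n; ≤-refl; ≤-antisym; ≤-trans; ≤-<-trans; <-trans; <-irrefl; ≤-pred; <⇒≤pred; n≤1+n; n<1+n; m≤n⇒m≤1+n; m≤m+n; ≤∧≢⇒<; <⇒≱; ≤⇒≯; ≰⇒>; ≮⇒≥; m+[n∸m]≡n; m+n∸n≡m; m+n∸m≡n; module ≤-Reasoning)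
open import Data.List.Membership.DecPropositional _≟_ using (_∈?_)
open import Data.Product using (_×_; _,_; proj₁; proj₂; map₁)
open import Data.Sum using (inj₁; inj₂)
open import Function using (_∘_; _∘′_; flip; _⇔_; mk⇔; Equivalence)
open import Function.Properties.Equivalence using () renaming (trans to ⇔-trans)
open import Level using (Level)
open import Relation.Binary.PropositionalEquality using (_≡_; _≢_; refl; sym; trans; cong; cong₂; subst; module ≡-Reasoning)
open import Relation.Nullary using (¬_; Dec; yes; no; does; contradiction)
open import Relation.Nullary.Decidable using (_×-dec_)
open import Relation.Unary using (Pred; Decidable)
open import Relation.Unary.Properties using (∁?; _∩?_)

private variable
  a p q : Level
  A : Set a

count : {P : Pred A p} → Decidable P → List A → ℕ
count P? xs = length (filter P? xs)

module _ {P : Pred A p} (P? : Decidable P) where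

  count-++ : ∀ xs ys → count P? (xs ++ ys) ≡ count P? xs + count P? ys
  count-++ xs ys = trans (cong length (filter-++ P? xs ys)) (length-++ (filter P? xs))

  count-complement : ∀ xs → count P? xs + count (∁? P?) xs ≡ length xs
  count-complement []       = refl
  count-complement (x ∷ xs) with P? x
  ... | yes _ = cong suc (count-complement xs)
  ... | no  _ = trans (+-suc _ _) (cong suc (count-complement xs))

  count-cong : {Q : Pred A q} (Q? : Decidable Q) → ∀ xs →
               (∀ {x} → x ∈ xs → P x → Q x) → (∀ {x} → x ∈ xs → Q x → P x) →
               count P? xs ≡ count Q? xs
  count-cong Q? []       _   _   = refl
  count-cong Q? (x ∷ xs) P⇒Q Q⇒P with P? x | Q? x
  ... | yes _  | yes _  = cong suc (count-cong Q? xs (P⇒Q ∘′ there) (Q⇒P ∘′ there))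
  ... | yes px | no ¬qx = contradiction (P⇒Q (here refl) px) ¬qx
  ... | no ¬px | yes qx = contradiction (Q⇒P (here refl) qx) ¬px
  ... | no  _  | no  _  = count-cong Q? xs (P⇒Q ∘′ there) (Q⇒P ∘′ there)

  count-split : {Q : Pred A q} (Q? : Decidable Q) → ∀ xs →
                count P? xs ≡ count (P? ∩? Q?) xs + count (P? ∩? ∁? Q?) xs
  count-split Q? []       = refl
  count-split Q? (x ∷ xs) with P? x | Q? x
  ... | yes _ | yes _ = cong suc (count-split Q? xs)
  ... | yes _ | no  _ = trans (cong suc (count-split Q? xs)) (sym (+-suc _ _))
  ... | no  _ | _     = count-split Q? xs

unique∧⊆⇒length≤ : {xs ys : List A} → Unique xs → xs ⊆ ys → length xs ≤ length ys
unique∧⊆⇒length≤ []                   _ = z≤n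
unique∧⊆⇒length≤ {xs = x ∷ xs} (x∉xs ∷ xs!) xs⊆ys with ∈-∃++ (xs⊆ys (here refl))
... | ys₁ , ys₂ , refl = begin
  suc (length xs)               ≤⟨ s≤s (unique∧⊆⇒length≤ xs! xs⊆ys₁++ys₂) ⟩
  suc (length (ys₁ ++ ys₂))     ≡⟨ cong suc (length-++ ys₁) ⟩
  suc (length ys₁ + length ys₂) ≡⟨ +-suc (length ys₁) (length ys₂) ⟨
  length ys₁ + length (x ∷ ys₂) ≡⟨ length-++ ys₁ ⟨
  length (ys₁ ++ x ∷ ys₂)       ∎
  where
  open ≤-Reasoning
  xs⊆ys₁++ys₂ : xs ⊆ ys₁ ++ ys₂
  xs⊆ys₁++ys₂ {y} y∈xs with ∈-++⁻ ys₁ (xs⊆ys (there y∈xs))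
  ... | inj₁ y∈ys₁         = ∈-++⁺ˡ y∈ys₁
  ... | inj₂ (here y≡x)    = contradiction (sym y≡x) (All.lookup x∉xs y∈xs)
  ... | inj₂ (there y∈ys₂) = ∈-++⁺ʳ ys₁ y∈ys₂

unique-witness⇒count≡1 : {P : Pred A p} (P? : Decidable P) → ∀ {x xs} → Unique xs → x ∈ xs → P x →
                         (∀ {y} → y ∈ xs → P y → y ≡ x) → count P? xs ≡ 1
unique-witness⇒count≡1 P? {x} {xs} xs! x∈xs px only-x = ≤-antisym
  (unique∧⊆⇒length≤ {ys = [ x ]} (Unique.filter⁺ P? xs!)
    λ y∈ → let y∈xs , py = ∈-filter⁻ P? y∈ in here (only-x y∈xs py))
  (filter-some P? {xs} (lose x∈xs px))

All≡⇒replicate : {x : A} {xs : List A} → All (_≡ x) xs → xs ≡ replicate (length xs) x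
All≡⇒replicate []            = refl
All≡⇒replicate (refl ∷ xs≡x) = cong (_ ∷_) (All≡⇒replicate xs≡x)

All≤⇔count[t<]≡0 : ∀ t r → All (_≤ t) r ⇔ count (t <?_) r ≡ 0
All≤⇔count[t<]≡0 t r = mk⇔
  (λ r≤t → cong length (filter-none (t <?_) (All.map ≤⇒≯ r≤t)))
  (λ #≡0 → All.map ≮⇒≥ (¬Any⇒All¬ r λ any → <-irrefl (sym #≡0) (filter-some (t <?_) any)))

Letter : ℕ → ℕ → Set
Letter k x = 1 ≤ x × x ≤ k

∈-letters⁺ : ∀ {k x} → Letter k x → x ∈ letters k
∈-letters⁺ {x = suc x} (_ , x<k) = ∈-map⁺ suc (∈-upTo⁺ x<k)

∈-letters⁻ : ∀ {k x} → x ∈ letters k → Letter k x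
∈-letters⁻ x∈ with ∈-map⁻ suc x∈
... | _ , y∈ , refl = s≤s z≤n , ∈-upTo⁻ y∈

letters-unique : ∀ k → Unique (letters k)
letters-unique k = Unique.map⁺ suc-injective (Unique.upTo⁺ k)

words-suc : ∀ n k → words (suc n) k ≡ cartesianProductWith (flip _∷_) (words n k) (letters k)
words-suc n k = go (words n k)
  where
  go : ∀ ws → concatMap (λ w → map (λ i → i ∷ w) (letters k)) ws ≡ cartesianProductWith (flip _∷_) ws (letters k)
  go []       = refl
  go (w ∷ ws) = cong (map (_∷ w) (letters k) ++_) (go ws)

∈-words⁺ : ∀ {k w} → All (Letter k) w → w ∈ words (length w) k
∈-words⁺ []                     = here refl
∈-words⁺ {k} {x ∷ w} (x∈ ∷ w∈) = subst (x ∷ w ∈_) (sym (words-suc (length w) k))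
  (∈-cartesianProductWith⁺ (flip _∷_) (∈-words⁺ w∈) (∈-letters⁺ x∈))

∈-words⁻ : ∀ {n k w} → w ∈ words n k → length w ≡ n × All (Letter k) w
∈-words⁻ {zero}      (here refl) = refl , []
∈-words⁻ {suc n} {k} w∈
  with ∈-cartesianProductWith⁻ (flip _∷_) (words n k) (letters k) (subst (_ ∈_) (words-suc n k) w∈)
... | v , x , v∈ , x∈ , refl with ∈-words⁻ {n} v∈
... | |v|≡n , v∈ᵏ = cong suc |v|≡n , ∈-letters⁻ x∈ ∷ v∈ᵏ

words-unique : ∀ n k → Unique (words n k)
words-unique zero    k = [] ∷ []
words-unique (suc n) k = subst Unique (sym (words-suc n k))
  (Unique.cartesianProductWith⁺ (flip _∷_) (λ eq → let x≡y , v≡w = ∷-injective eq in v≡w , x≡y)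
    (words-unique n k) (letters-unique k))

count-words₂-suc : {P : Pred Word p} (P? : Decidable P) → ∀ n →
  count P? (words (suc n) 2) ≡ count (P? ∘ (1 ∷_)) (words n 2) + count (P? ∘ (2 ∷_)) (words n 2)
count-words₂-suc P? n = trans (cong (count P?) (words-suc n 2)) (go (words n 2))
  where
  go : ∀ ws → count P? (cartesianProductWith (flip _∷_) ws (letters 2)) ≡
              count (P? ∘ (1 ∷_)) ws + count (P? ∘ (2 ∷_)) ws
  go []       = refl
  go (w ∷ ws) with does (P? (1 ∷ w))
  ... | true  with does (P? (2 ∷ w))
  ...   | true  = cong suc (trans (cong suc (go ws)) (sym (+-suc _ _)))
  ...   | false = cong suc (go ws)
  go (w ∷ ws) | false with does (P? (2 ∷ w))
  ...   | true  = trans (cong suc (go ws)) (sym (+-suc _ _))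
  ...   | false = go ws

infixl 4.5 _←_

_←_ : List ℕ → ℕ → List ℕ
r ← x = proj₁ (insertRow x r)

module _ {x y : ℕ} {r : List ℕ} where

  insertRow-< : x < y → insertRow x (y ∷ r) ≡ (x ∷ r , just y)
  insertRow-< x<y with x <? y
  ... | yes _   = refl
  ... | no  x≮y = contradiction x<y x≮y

  insertRow-≮ : ¬ x < y → insertRow x (y ∷ r) ≡ map₁ (y ∷_) (insertRow x r)
  insertRow-≮ x≮y with x <? y
  ... | yes x<y = contradiction x<y x≮y
  ... | no  _   = refl

  ←-< : x < y → y ∷ r ← x ≡ x ∷ r
  ←-< = cong proj₁ ∘ insertRow-<

  ←-≮ : ¬ x < y → y ∷ r ← x ≡ y ∷ (r ← x)
  ←-≮ = cong proj₁ ∘ insertRow-≮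

module _ {q} {Q : Pred ℕ q} where

  All-← : ∀ {x r} → Q x → All Q r → All Q (r ← x)
  All-← qx [] = qx ∷ []
  All-← {x} qx (_∷_ {y} qy qr) with x <? y
  ... | yes _ = qx ∷ qr
  ... | no  _ = qy ∷ All-← qx qr

  All-foldl-← : ∀ {r w} → All Q r → All Q w → All Q (foldl _←_ r w)
  All-foldl-← qr []        = qr
  All-foldl-← qr (qx ∷ qw) = All-foldl-← (All-← qx qr) qw

length-← : ∀ r x → length r ≤ length (r ← x)
length-← []      x = z≤n
length-← (y ∷ r) x with x <? y
... | yes _ = ≤-refl
... | no  _ = s≤s (length-← r x)

length-foldl-← : ∀ r w → length r ≤ length (foldl _←_ r w)
length-foldl-← r []      = ≤-refl
length-foldl-← r (x ∷ w) = ≤-trans (length-← r x) (length-foldl-← (r ← x) w)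

length-←-bump : ∀ {x r} → Any (x <_) r → length (r ← x) ≡ length r
length-←-bump {x} {y ∷ r} (here x<y)  = cong length (←-< x<y)
length-←-bump {x} {y ∷ r} (there bump) with x <? y
... | yes _ = refl
... | no  _ = cong suc (length-←-bump bump)

←≡∷⇒All≤ : ∀ {x r} → r ← x ≡ x ∷ r → All (_≤ x) r
←≡∷⇒All≤ {x} {r} eq = All.map ≮⇒≥ (¬Any⇒All¬ r λ bump →
  1+n≢n (trans (cong length (sym eq)) (length-←-bump bump)))

insertRow-All≡ : ∀ {x r} → All (_≡ x) r → insertRow x r ≡ (x ∷ r , nothing)
insertRow-All≡ []           = refl
insertRow-All≡ (refl ∷ r≡x) = trans (insertRow-≮ (<-irrefl refl)) (cong (map₁ (_ ∷_)) (insertRow-All≡ r≡x))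

←-append : ∀ {x r} → All (_≤ x) r → r ← x ≡ r ++ [ x ]
←-append []                = refl
←-append (y≤x ∷ r≤x) = trans (←-≮ (≤⇒≯ y≤x)) (cong (_ ∷_) (←-append r≤x))

count[x<]-←x : ∀ x r → count (x <?_) (r ← x) ≡ count (x <?_) r ∸ 1
count[x<]-←x x [] = cong length (filter-reject (x <?_) (<-irrefl refl))
count[x<]-←x x (y ∷ r) = by-cases (x <? y)
  where
  open ≡-Reasoning
  by-cases : Dec (x < y) → count (x <?_) (y ∷ r ← x) ≡ count (x <?_) (y ∷ r) ∸ 1
  by-cases (yes x<y) = begin
      count (x <?_) (y ∷ r ← x) ≡⟨ cong (count (x <?_)) (←-< x<y) ⟩
      count (x <?_) (x ∷ r)     ≡⟨ cong length (filter-reject (x <?_) (<-irrefl refl)) ⟩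
      count (x <?_) r           ≡⟨ cong (λ xs → length xs ∸ 1) (filter-accept (x <?_) x<y) ⟨
      count (x <?_) (y ∷ r) ∸ 1 ∎
  by-cases (no x≮y) = begin
      count (x <?_) (y ∷ r ← x)   ≡⟨ cong (count (x <?_)) (←-≮ x≮y) ⟩
      count (x <?_) (y ∷ (r ← x)) ≡⟨ cong length (filter-reject (x <?_) x≮y) ⟩
      count (x <?_) (r ← x)       ≡⟨ count[x<]-←x x r ⟩
      count (x <?_) r ∸ 1         ≡⟨ cong (λ xs → length xs ∸ 1) (filter-reject (x <?_) x≮y) ⟨
      count (x <?_) (y ∷ r) ∸ 1   ∎

count[≤t]-← : ∀ {t x} r → t ≤ x → count (_≤? t) (r ← x) ≡ count (_≤? t) (r ++ [ x ])
count[≤t]-← []      t≤x = refl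
count[≤t]-← {t} {x} (y ∷ r) t≤x = by-cases (x <? y)
  where
  open ≡-Reasoning
  by-cases : Dec (x < y) → count (_≤? t) (y ∷ r ← x) ≡ count (_≤? t) (y ∷ r ++ [ x ])
  by-cases (yes x<y) = begin
      count (_≤? t) (y ∷ r ← x)             ≡⟨ cong (count (_≤? t)) (←-< x<y) ⟩
      count (_≤? t) (x ∷ r)                 ≡⟨ count-++ (_≤? t) [ x ] r ⟩
      count (_≤? t) [ x ] + count (_≤? t) r ≡⟨ +-comm (count (_≤? t) [ x ]) _ ⟩
      count (_≤? t) r + count (_≤? t) [ x ] ≡⟨ count-++ (_≤? t) r [ x ] ⟨
      count (_≤? t) (r ++ [ x ])            ≡⟨ cong length (filter-reject (_≤? t) (<⇒≱ (≤-<-trans t≤x x<y))) ⟨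
      count (_≤? t) (y ∷ r ++ [ x ])        ∎
  by-cases (no x≮y) = begin
      count (_≤? t) (y ∷ r ← x)                        ≡⟨ cong (count (_≤? t)) (←-≮ x≮y) ⟩
      count (_≤? t) ([ y ] ++ (r ← x))                 ≡⟨ count-++ (_≤? t) [ y ] (r ← x) ⟩
      count (_≤? t) [ y ] + count (_≤? t) (r ← x)      ≡⟨ cong (count (_≤? t) [ y ] +_) (count[≤t]-← r t≤x) ⟩
      count (_≤? t) [ y ] + count (_≤? t) (r ++ [ x ]) ≡⟨ count-++ (_≤? t) [ y ] (r ++ [ x ]) ⟨
      count (_≤? t) (y ∷ r ++ [ x ])                   ∎

count[≤t]-foldl-← : ∀ {t} r {w} → All (t ≤_) w → count (_≤? t) (foldl _←_ r w) ≡ count (_≤? t) (r ++ w)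
count[≤t]-foldl-← r [] = cong (count _) (sym (++-identityʳ r))
count[≤t]-foldl-← {t} r {x ∷ w} (t≤x ∷ t≤w) = begin
  count (_≤? t) (foldl _←_ (r ← x) w)          ≡⟨ count[≤t]-foldl-← (r ← x) t≤w ⟩
  count (_≤? t) ((r ← x) ++ w)                 ≡⟨ count-++ (_≤? t) (r ← x) w ⟩
  count (_≤? t) (r ← x) + count (_≤? t) w      ≡⟨ cong (_+ count (_≤? t) w) (count[≤t]-← r t≤x) ⟩
  count (_≤? t) (r ++ [ x ]) + count (_≤? t) w ≡⟨ count-++ (_≤? t) (r ++ [ x ]) w ⟨
  count (_≤? t) ((r ++ [ x ]) ++ w)            ≡⟨ cong (count (_≤? t)) (++-assoc r [ x ] w) ⟩
  count (_≤? t) (r ++ x ∷ w)                   ∎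
  where open ≡-Reasoning

-- The first row, and commuting with a letter

firstRow : Tableau → List ℕ
firstRow []      = []
firstRow (r ∷ _) = r

stackRow : Tableau → List ℕ × Maybe ℕ → Tableau
stackRow rs (r , m) = r ∷ maybe′ (λ y → insertT y rs) rs m

insertT-∷ : ∀ x r rs → insertT x (r ∷ rs) ≡ stackRow rs (insertRow x r)
insertT-∷ x r rs with insertRow x r
... | r′ , nothing = refl
... | r′ , just y  = refl

firstRow-insertT : ∀ x T → firstRow (insertT x T) ≡ firstRow T ← x
firstRow-insertT x []       = refl
firstRow-insertT x (r ∷ rs) = cong firstRow (insertT-∷ x r rs)

insertWord : Tableau → Word → Tableau
insertWord = foldl (λ T x → insertT x T)

firstRow-insertWord : ∀ T w → firstRow (insertWord T w) ≡ foldl _←_ (firstRow T) w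
firstRow-insertWord T []      = refl
firstRow-insertWord T (x ∷ w) =
  trans (firstRow-insertWord (insertT x T) w) (cong (λ r → foldl _←_ r w) (firstRow-insertT x T))

firstRow-P : ∀ w → firstRow (P w) ≡ foldl _←_ [] w
firstRow-P = firstRow-insertWord []

infixr 5 _∷₁_

_∷₁_ : ℕ → Tableau → Tableau
x ∷₁ []       = [ [ x ] ]
x ∷₁ (r ∷ rs) = (x ∷ r) ∷ rs

insertT-∷₁ : ∀ {x y} → ¬ y < x → ∀ T → insertT y (x ∷₁ T) ≡ x ∷₁ insertT y T
insertT-∷₁ {x} {y} y≮x [] = trans (insertT-∷ y [ x ] []) (cong (stackRow []) (insertRow-≮ y≮x))
insertT-∷₁ {x} {y} y≮x (r ∷ rs) = begin
  insertT y ((x ∷ r) ∷ rs)          ≡⟨ insertT-∷ y (x ∷ r) rs ⟩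
  stackRow rs (insertRow y (x ∷ r)) ≡⟨ cong (stackRow rs) (insertRow-≮ y≮x) ⟩
  x ∷₁ stackRow rs (insertRow y r)  ≡⟨ cong (x ∷₁_) (insertT-∷ y r rs) ⟨
  x ∷₁ insertT y (r ∷ rs)           ∎
  where open ≡-Reasoning

insertWord-∷₁ : ∀ {x} T {w} → All (x ≤_) w → insertWord (x ∷₁ T) w ≡ x ∷₁ insertWord T w
insertWord-∷₁ T []                      = refl
insertWord-∷₁ T {y ∷ w} (x≤y ∷ x≤w) =
  trans (cong (λ T′ → insertWord T′ w) (insertT-∷₁ (≤⇒≯ x≤y) T)) (insertWord-∷₁ (insertT y T) x≤w)

P-∷ : ∀ {x w} → All (x ≤_) w → P (x ∷ w) ≡ x ∷₁ P w
P-∷ = insertWord-∷₁ []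

insertT≡∷₁⇔firstRow≤ : ∀ {x} T → All (x ≤_) (firstRow T) → (insertT x T ≡ x ∷₁ T) ⇔ All (_≤ x) (firstRow T)
insertT≡∷₁⇔firstRow≤ []       _   = mk⇔ (λ _ → []) (λ _ → refl)
insertT≡∷₁⇔firstRow≤ (r ∷ rs) x≤r = mk⇔
  (λ eq → ←≡∷⇒All≤ (trans (sym (firstRow-insertT _ (r ∷ rs))) (cong firstRow eq)))
  (λ r≤x → trans (insertT-∷ _ r rs)
    (cong (stackRow rs) (insertRow-All≡ (All.zipWith (λ (x≤y , y≤x) → ≤-antisym y≤x x≤y) (x≤r , r≤x)))))

InC[x]⇔firstRow≤x : ∀ {x w} → All (x ≤_) w → InC [ x ] w ⇔ All (_≤ x) (firstRow (P w))
InC[x]⇔firstRow≤x {x} {w} x≤w = mk⇔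
  (λ inC → to (trans (sym P[w++x]) (trans (sym inC) (P-∷ x≤w))))
  (λ row≤x → trans (P-∷ x≤w) (trans (sym (from row≤x)) (sym P[w++x])))
  where
  open Equivalence (insertT≡∷₁⇔firstRow≤ (P w) (subst (All (x ≤_)) (sym (firstRow-P w)) (All-foldl-← [] x≤w)))
  P[w++x] : P (w ++ [ x ]) ≡ insertT x (P w)
  P[w++x] = foldl-++ _ [] w [ x ]

down : ℕ → Word
down zero    = []
down (suc k) = suc k ∷ down k

down-letters : ∀ k → All (Letter k) (down k)
down-letters zero    = []
down-letters (suc k) = (s≤s z≤n , ≤-refl) ∷ All.map (λ (1≤x , x≤k) → 1≤x , ≤-trans x≤k (n≤1+n k)) (down-letters k)

∈-down : ∀ k {x} → Letter k x → x ∈ down k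
∈-down zero        (1≤x , x≤0) = contradiction (≤-trans 1≤x x≤0) λ ()
∈-down (suc k) {x} (1≤x , x≤1+k) with x ≟ suc k
... | yes refl  = here refl
... | no  x≢1+k = there (∈-down k (1≤x , <⇒≤pred (≤∧≢⇒< x≤1+k x≢1+k)))

length-down : ∀ k → length (down k) ≡ k
length-down zero    = refl
length-down (suc k) = cong suc (length-down k)

length≤1⇒decreasing : ∀ w → length (foldl _←_ [] w) ≤ 1 → Linked _>_ w
length≤1⇒decreasing []      _ = []
length≤1⇒decreasing (x ∷ w) = go x w
  where
  go : ∀ x w → length (foldl _←_ [ x ] w) ≤ 1 → Linked _>_ (x ∷ w)
  go x []      _     = [-]
  go x (y ∷ w) |row| = by-cases (y <? x)
    where
    by-cases : Dec (y < x) → Linked _>_ (x ∷ y ∷ w)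
    by-cases (yes y<x) = y<x ∷ go y w (subst (λ r → length (foldl _←_ r w) ≤ 1) (←-< y<x) |row|)
    by-cases (no  y≮x) = contradiction
      (≤-trans (length-foldl-← (x ∷ [ y ]) w) (subst (λ r → length (foldl _←_ r w) ≤ 1) (←-≮ y≮x) |row|))
      λ { (s≤s ()) }

decreasing⇒All<head : ∀ {x w} → Linked _>_ (x ∷ w) → All (_< x) w
decreasing⇒All<head [-]         = []
decreasing⇒All<head (x>y ∷ y∷w) = Linked⇒All (λ y<x z<y → <-trans z<y y<x) x>y y∷w

decreasing⇒down : ∀ k {w} → Linked _>_ w → length w ≡ k → All (Letter k) w → w ≡ down k
decreasing⇒down zero    {[]}    _   _   _                       = refl
decreasing⇒down (suc m) {x ∷ w} x∷w |x∷w| ((1≤x , x≤1+m) ∷ w∈) =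
  cong₂ _∷_ (≤-antisym x≤1+m (m<x (subst (All (_< x)) w≡down (decreasing⇒All<head x∷w)))) w≡down
  where
  w≡down : w ≡ down m
  w≡down = decreasing⇒down m (Linked.tail x∷w) (suc-injective |x∷w|)
    (All.zipWith (λ ((1≤y , _) , y<x) → 1≤y , ≤-pred (≤-trans y<x x≤1+m)) (w∈ , decreasing⇒All<head x∷w))
  m<x : ∀ {m} → All (_< x) (down m) → m < x
  m<x {zero}  _         = 1≤x
  m<x {suc _} (m<x ∷ _) = m<x

foldl-←-down : ∀ m → foldl _←_ [] (down (suc m)) ≡ [ 1 ]
foldl-←-down zero    = refl
foldl-←-down (suc m) = go m ≤-refl
  where
  go : ∀ m {x} → suc m < x → foldl _←_ [ x ] (down (suc m)) ≡ [ 1 ]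
  go zero    1<x = ←-< 1<x
  go (suc m) 2+m<x = trans (cong (λ r → foldl _←_ r (down (suc m))) (←-< 2+m<x)) (go m ≤-refl)

-- Positivity, and the case k = 1

ones : ℕ → Word
ones r = replicate r 1

witness : ℕ → ℕ → Word
witness k r = down k ++ ones r

witness-letters : ∀ {k} r → 1 ≤ k → All (Letter k) (witness k r)
witness-letters {k} r 1≤k = ++⁺ (down-letters k) (replicate⁺ r (≤-refl , 1≤k))

witness-∈ : ∀ {k} r → 1 ≤ k → witness k r ∈ words (k + r) k
witness-∈ {k} r 1≤k = subst (λ n → witness k r ∈ words n k) |witness|≡k+r (∈-words⁺ (witness-letters r 1≤k))
  where
  |witness|≡k+r : length (witness k r) ≡ k + r
  |witness|≡k+r = trans (length-++ (down k)) (cong₂ _+_ (length-down k) (length-replicate r))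

witness-packed : ∀ k r → Packed k (witness k r)
witness-packed k r = All.tabulate (∈-++⁺ˡ ∘ ∈-down k ∘ ∈-letters⁻)

witness-commutes : ∀ m r → InC [ 1 ] (witness (suc m) r)
witness-commutes m r = Equivalence.from (InC[x]⇔firstRow≤x (All.map proj₁ (witness-letters {suc m} r (s≤s z≤n))))
  (subst (All (_≤ 1)) (sym firstRow≡) (All-foldl-← (≤-refl ∷ []) (replicate⁺ r ≤-refl)))
  where
  firstRow≡ : firstRow (P (witness (suc m) r)) ≡ foldl _←_ [ 1 ] (ones r)
  firstRow≡ = begin
    firstRow (P (witness (suc m) r))                 ≡⟨ firstRow-P (witness (suc m) r) ⟩
    foldl _←_ [] (down (suc m) ++ ones r)            ≡⟨ foldl-++ _←_ [] (down (suc m)) (ones r) ⟩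
    foldl _←_ (foldl _←_ [] (down (suc m))) (ones r) ≡⟨ cong (λ r′ → foldl _←_ r′ (ones r)) (foldl-←-down m) ⟩
    foldl _←_ [ 1 ] (ones r)                         ∎
    where open ≡-Reasoning

b-positive : ∀ {n k} → 1 ≤ k → k ≤ n → 1 ≤ b n k
b-positive {n} {suc m} 1≤k k≤n = filter-some (Packed? (suc m) ∩? InC? [ 1 ]) {words n (suc m)}
  (lose (subst (λ n′ → witness (suc m) (n ∸ suc m) ∈ words n′ (suc m)) (m+[n∸m]≡n k≤n) (witness-∈ (n ∸ suc m) 1≤k))
        (witness-packed (suc m) (n ∸ suc m) , witness-commutes m (n ∸ suc m)))

b-one : ∀ r → b (suc r) 1 ≡ 1
b-one r = unique-witness⇒count≡1 (Packed? 1 ∩? InC? [ 1 ]) (words-unique (suc r) 1) (witness-∈ r ≤-refl)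
  (witness-packed 1 r , witness-commutes 0 r) only-ones
  where
  only-ones : ∀ {v} → v ∈ words (suc r) 1 → Packed 1 v × InC [ 1 ] v → v ≡ ones (suc r)
  only-ones v∈ _ with ∈-words⁻ v∈
  ... | |v|≡1+r , v∈¹ = trans (All≡⇒replicate (All.map (λ (1≤x , x≤1) → ≤-antisym x≤1 1≤x) v∈¹)) (cong ones |v|≡1+r)

-- The case k = n

-- Pigeonhole: letters (suc m) unfolds to 1 ∷ larger, and the m letters of larger
-- all occur in w at positions not holding a 1.
packed⇒count[≤1]≤1 : ∀ {m w} → length w ≡ suc m → Packed (suc m) w → count (_≤? 1) w ≤ 1
packed⇒count[≤1]≤1 {m} {w} |w|≡1+m (_ ∷ larger⊆w) = +-cancelʳ-≤ m _ 1 (begin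
  count (_≤? 1) w + m                    ≤⟨ +-monoʳ-≤ (count (_≤? 1) w) m≤#larger ⟩
  count (_≤? 1) w + count (∁? (_≤? 1)) w ≡⟨ count-complement (_≤? 1) w ⟩
  length w                               ≡⟨ |w|≡1+m ⟩
  1 + m                                  ∎)
  where
  open ≤-Reasoning
  larger : List ℕ
  larger = map suc (applyUpTo suc m)
  larger! : Unique larger
  larger! with letters-unique (suc m)
  ... | _ ∷ larger! = larger!
  >1 : ∀ {z} → z ∈ larger → ¬ z ≤ 1
  >1 z∈ with ∈-map⁻ suc z∈
  ... | _ , i∈ , refl with ∈-applyUpTo⁻ suc i∈
  ... | _ , _ , refl = λ { (s≤s ()) }
  m≤#larger : m ≤ count (∁? (_≤? 1)) w
  m≤#larger = subst (_≤ count (∁? (_≤? 1)) w) (trans (length-map suc (applyUpTo suc m)) (length-applyUpTo suc m))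
    (unique∧⊆⇒length≤ larger! λ z∈ → ∈-filter⁺ (∁? (_≤? 1)) (All.lookup larger⊆w z∈) (>1 z∈))

packed-commuting⇒down : ∀ m {w} → w ∈ words (suc m) (suc m) → Packed (suc m) w → InC [ 1 ] w → w ≡ down (suc m)
packed-commuting⇒down m {w} w∈ packed commutes = decreasing⇒down (suc m) decreasing |w|≡1+m w∈ᵏ
  where
  |w|≡1+m = proj₁ (∈-words⁻ {suc m} w∈)
  w∈ᵏ     = proj₂ (∈-words⁻ {suc m} w∈)
  1≤w : All (1 ≤_) w
  1≤w = All.map proj₁ w∈ᵏ
  row≤1 : All (_≤ 1) (foldl _←_ [] w)
  row≤1 = subst (All (_≤ 1)) (firstRow-P w) (Equivalence.to (InC[x]⇔firstRow≤x 1≤w) commutes)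
  |row|≡#1 : length (foldl _←_ [] w) ≡ count (_≤? 1) w
  |row|≡#1 = trans (cong length (sym (filter-all (_≤? 1) row≤1))) (count[≤t]-foldl-← [] 1≤w)
  decreasing : Linked _>_ w
  decreasing = length≤1⇒decreasing w (subst (_≤ 1) (sym |row|≡#1) (packed⇒count[≤1]≤1 |w|≡1+m packed))

b-diagonal : ∀ m → b (suc m) (suc m) ≡ 1
b-diagonal m = unique-witness⇒count≡1 (Packed? (suc m) ∩? InC? [ 1 ]) (words-unique (suc m) (suc m))
  (subst (λ n → witness (suc m) 0 ∈ words n (suc m)) (+-comm (suc m) 0) (witness-∈ 0 (s≤s z≤n)))
  (witness-packed (suc m) 0 , witness-commutes m 0)
  λ v∈ (packed , commutes) → trans (packed-commuting⇒down m v∈ packed commutes) (sym (++-identityʳ (down (suc m))))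

-- The case k = 2

-- Reading 2 as an opening and 1 as a closing bracket (and any other letter as 2),
-- depth c w is the number of brackets of 2ᶜw left open; a closing bracket with
-- nothing open is ignored.
bracket : ℕ → ℕ → ℕ
bracket c 1 = c ∸ 1
bracket c _ = suc c

depth : ℕ → Word → ℕ
depth = foldl bracket

count[1<]-foldl-←≡depth : ∀ {r} w → All (_≤ 2) r → All (Letter 2) w →
                          count (1 <?_) (foldl _←_ r w) ≡ depth (count (1 <?_) r) w
count[1<]-foldl-←≡depth [] _ [] = refl
count[1<]-foldl-←≡depth {r} (1 ∷ w) r≤2 (_ ∷ w∈) =
  trans (count[1<]-foldl-←≡depth w (All-← (s≤s z≤n) r≤2) w∈) (cong (λ c → depth c w) (count[x<]-←x 1 r))
count[1<]-foldl-←≡depth {r} (2 ∷ w) r≤2 (_ ∷ w∈) =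
  trans (count[1<]-foldl-←≡depth w (All-← ≤-refl r≤2) w∈) (cong (λ c → depth c w) #[r←2])
  where
  #[r←2] : count (1 <?_) (r ← 2) ≡ suc (count (1 <?_) r)
  #[r←2] = trans (cong (count (1 <?_)) (←-append r≤2)) (trans (count-++ (1 <?_) r [ 2 ]) (+-comm _ 1))
count[1<]-foldl-←≡depth (0 ∷ _)                 _ ((() , _) ∷ _)
count[1<]-foldl-←≡depth (suc (suc (suc _)) ∷ _) _ ((_ , s≤s (s≤s ())) ∷ _)

InC[1]⇔depth≡0 : ∀ {w} → All (Letter 2) w → InC [ 1 ] w ⇔ depth 0 w ≡ 0
InC[1]⇔depth≡0 {w} w∈ = ⇔-trans (InC[x]⇔firstRow≤x (All.map proj₁ w∈))
  (subst (λ d → All (_≤ 1) (firstRow (P w)) ⇔ d ≡ 0) #row≡depth (All≤⇔count[t<]≡0 1 (firstRow (P w))))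
  where
  #row≡depth : count (1 <?_) (firstRow (P w)) ≡ depth 0 w
  #row≡depth = trans (cong (count (1 <?_)) (firstRow-P w)) (count[1<]-foldl-←≡depth w [] w∈)

+-suc-suc : ∀ c j → c + suc j + suc j ≡ suc (suc c + j + j)
+-suc-suc c j = trans (cong (_+ suc j) (+-suc c j)) (cong suc (+-suc (c + j) j))

depth≡0⇒length-bound : ∀ {c} w → All (Letter 2) w → depth c w ≡ 0 → c + count (1 <?_) w + count (1 <?_) w ≤ length w
depth≡0⇒length-bound []                  []       refl = z≤n
depth≡0⇒length-bound {zero}  (1 ∷ w)     (_ ∷ w∈) d    = m≤n⇒m≤1+n (depth≡0⇒length-bound w w∈ d)
depth≡0⇒length-bound {suc c} (1 ∷ w)     (_ ∷ w∈) d    = s≤s (depth≡0⇒length-bound w w∈ d)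
depth≡0⇒length-bound {c}     (2 ∷ w)     (_ ∷ w∈) d    =
  subst (_≤ suc (length w)) (sym (+-suc-suc c _)) (s≤s (depth≡0⇒length-bound w w∈ d))
depth≡0⇒length-bound (0 ∷ _)                 ((() , _) ∷ _)
depth≡0⇒length-bound (suc (suc (suc _)) ∷ _) ((_ , s≤s (s≤s ())) ∷ _)

depth>0⇒1∈ : ∀ {c} w → All (Letter 2) w → depth (suc c) w ≡ 0 → 1 ∈ w
depth>0⇒1∈ (1 ∷ w) _        _ = here refl
depth>0⇒1∈ (2 ∷ w) (_ ∷ w∈) d = there (depth>0⇒1∈ w w∈ d)
depth>0⇒1∈ (0 ∷ _)                 ((() , _) ∷ _)
depth>0⇒1∈ (suc (suc (suc _)) ∷ _) ((_ , s≤s (s≤s ())) ∷ _)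

depth≡0⇒2∈⇒1∈ : ∀ {c} w → All (Letter 2) w → depth c w ≡ 0 → 2 ∈ w → 1 ∈ w
depth≡0⇒2∈⇒1∈ (1 ∷ w) _        _ _ = here refl
depth≡0⇒2∈⇒1∈ (2 ∷ w) (_ ∷ w∈) d _ = there (depth>0⇒1∈ w w∈ d)
depth≡0⇒2∈⇒1∈ (0 ∷ _)                 ((() , _) ∷ _)
depth≡0⇒2∈⇒1∈ (suc (suc (suc _)) ∷ _) ((_ , s≤s (s≤s ())) ∷ _)

#matched : ℕ → ℕ → ℕ → ℕ
#matched n c j = count (λ w → depth c w ≟ 0 ×-dec count (1 <?_) w ≤? j) (words n 2)

double≤odd⇒≤ : ∀ {t j} → t + t ≤ j + suc j → t ≤ j
double≤odd⇒≤ {t} {j} t+t≤ with t ≤? j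
... | yes t≤j = t≤j
... | no  t≰j = contradiction t+t≤ (<⇒≱ (begin-strict
  j + suc j     <⟨ +-monoˡ-< (suc j) (n<1+n j) ⟩
  suc j + suc j ≤⟨ +-mono-≤ (≰⇒> t≰j) (≰⇒> t≰j) ⟩
  t + t         ∎))
  where open ≤-Reasoning

-- A word of length 2j+1 and depth 0 has at most j letters 2, and C(2j+1,j) = C(2j+1,j+1).
#matched-odd : ∀ j → #matched (j + suc j) 0 j ≡ (j + suc j) C j → #matched (j + suc j) 0 (suc j) ≡ (j + suc j) C suc j
#matched-odd j #≡C = begin
  #matched (j + suc j) 0 (suc j) ≡⟨ count-cong _ _ (words (j + suc j) 2) at-most-j (λ _ (d≡0 , t≤j) → d≡0 , m≤n⇒m≤1+n t≤j) ⟩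
  #matched (j + suc j) 0 j       ≡⟨ #≡C ⟩
  (j + suc j) C j                ≡⟨ nCk≡nC[n∸k] (m≤m+n j (suc j)) ⟩
  (j + suc j) C (j + suc j ∸ j)  ≡⟨ cong ((j + suc j) C_) (m+n∸m≡n j (suc j)) ⟩
  (j + suc j) C suc j            ∎
  where
  open ≡-Reasoning
  at-most-j : ∀ {w} → w ∈ words (j + suc j) 2 → depth 0 w ≡ 0 × count (1 <?_) w ≤ suc j → depth 0 w ≡ 0 × count (1 <?_) w ≤ j
  at-most-j {w} w∈ (d≡0 , _) = d≡0 , double≤odd⇒≤ (subst (count (1 <?_) w + count (1 <?_) w ≤_) |w|≡n (depth≡0⇒length-bound w w∈² d≡0))
    where
    |w|≡n = proj₁ (∈-words⁻ {j + suc j} w∈)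
    w∈²   = proj₂ (∈-words⁻ {j + suc j} w∈)

#matched≡C : ∀ n c j → c + j + j ≤ n → #matched n c j ≡ n C j
#matched≡C zero    zero    zero    _   = refl
#matched≡C (suc n) c       zero    le  = begin
  #matched (suc n) c 0                              ≡⟨ count-words₂-suc _ n ⟩
  #matched n (c ∸ 1) 0 + count after-2? (words n 2) ≡⟨ cong₂ _+_ (#matched≡C n (c ∸ 1) 0 (c∸1≤n c le)) starting-2 ⟩
  n C 0 + 0                                         ∎
  where
  open ≡-Reasoning
  after-2? = λ w → depth (suc c) w ≟ 0 ×-dec suc (count (1 <?_) w) ≤? 0
  starting-2 : count after-2? (words n 2) ≡ 0
  starting-2 = cong length (filter-none after-2? {words n 2} (All.tabulate λ _ → λ { (_ , ()) }))
  c∸1≤n : ∀ c → c + 0 + 0 ≤ suc n → c ∸ 1 + 0 + 0 ≤ n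
  c∸1≤n zero    _  = z≤n
  c∸1≤n (suc c) le = ≤-pred le
#matched≡C (suc n) c       (suc j) le  = begin
  #matched (suc n) c (suc j)                              ≡⟨ count-words₂-suc _ n ⟩
  #matched n (c ∸ 1) (suc j) + count after-2? (words n 2) ≡⟨ cong₂ _+_ (starting-1 c le) starting-2 ⟩
  n C suc j + n C j                                       ≡⟨ +-comm (n C suc j) (n C j) ⟩
  n C j + n C suc j                                       ≡⟨ nCk+nC[k+1]≡[n+1]C[k+1] n j ⟩
  suc n C suc j                                           ∎
  where
  open ≡-Reasoning
  after-2? = λ w → depth (suc c) w ≟ 0 ×-dec suc (count (1 <?_) w) ≤? suc j
  starting-2 : count after-2? (words n 2) ≡ n C j
  starting-2 = trans
    (count-cong _ _ (words n 2) (λ _ (d≡0 , 1+t≤1+j) → d≡0 , ≤-pred 1+t≤1+j) (λ _ (d≡0 , t≤j) → d≡0 , s≤s t≤j))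
    (#matched≡C n (suc c) j (≤-pred (subst (_≤ suc n) (+-suc-suc c j) le)))
  starting-1 : ∀ c → c + suc j + suc j ≤ suc n → #matched n (c ∸ 1) (suc j) ≡ n C suc j
  starting-1 (suc c) le = #matched≡C n c (suc j) (≤-pred le)
  starting-1 zero    le with suc j + suc j ≤? n
  ... | yes le′ = #matched≡C n 0 (suc j) le′
  -- otherwise n = 2j+1
  ... | no  ≰n  rewrite ≤-antisym (≤-pred (≰⇒> ≰n)) (≤-pred le) =
    #matched-odd j (#matched≡C (j + suc j) 0 j (+-monoʳ-≤ j (n≤1+n j)))

m+m≤n⇒m≤n/2 : ∀ {m n} → m + m ≤ n → m ≤ n / 2
m+m≤n⇒m≤n/2 {m} {n} m+m≤n = subst (_≤ n / 2) (m*n/n≡m m 2) (/-monoˡ-≤ 2 (subst (_≤ n) (sym (m*2≡m+m m)) m+m≤n))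
  where
  m*2≡m+m : ∀ m → m * 2 ≡ m + m
  m*2≡m+m m = trans (*-comm m 2) (cong (m +_) (+-identityʳ m))

n/2+n/2≤n : ∀ n → n / 2 + n / 2 ≤ n
n/2+n/2≤n n = subst (_≤ n) (trans (*-comm (n / 2) 2) (cong (n / 2 +_) (+-identityʳ (n / 2)))) (m/n*n≤m n 2)

2∉ones : ∀ n → 2 ∉ ones n
2∉ones (suc n) (there 2∈) = 2∉ones n 2∈

depth-ones : ∀ n → depth 0 (ones n) ≡ 0
depth-ones zero    = refl
depth-ones (suc n) = depth-ones n

ones∈words : ∀ n {k} → 1 ≤ k → ones n ∈ words n k
ones∈words n 1≤k = subst (λ n′ → ones n ∈ words n′ _) (length-replicate n) (∈-words⁺ (replicate⁺ n (≤-refl , 1≤k)))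

count[1<]-ones : ∀ n → count (1 <?_) (ones n) ≡ 0
count[1<]-ones n = cong length (filter-none (1 <?_) (replicate⁺ n (<-irrefl refl)))

without-2⇒ones : ∀ {n v} → v ∈ words n 2 → 2 ∉ v → v ≡ ones n
without-2⇒ones {n} {v} v∈ 2∉v = trans (All≡⇒replicate (All.zipWith ≡1 (v∈² , ¬Any⇒All¬ v 2∉v))) (cong ones |v|≡n)
  where
  |v|≡n = proj₁ (∈-words⁻ {n} v∈)
  v∈²   = proj₂ (∈-words⁻ {n} v∈)
  ≡1 : ∀ {x} → Letter 2 x × 2 ≢ x → x ≡ 1
  ≡1 ((1≤x , x≤2) , 2≢x) = ≤-antisym (≤-pred (≤∧≢⇒< x≤2 (2≢x ∘ sym))) 1≤x

packed₂∧commutes⇔ : ∀ {n w} → w ∈ words n 2 →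
                    (Packed 2 w × InC [ 1 ] w) ⇔ ((depth 0 w ≡ 0 × count (1 <?_) w ≤ n / 2) × 2 ∈ w)
packed₂∧commutes⇔ {n} {w} w∈ = mk⇔
  (λ { ((_ ∷ 2∈w ∷ []) , commutes) → (to commutes , #2≤n/2 (to commutes)) , 2∈w })
  (λ { ((d≡0 , _) , 2∈w) → (depth≡0⇒2∈⇒1∈ w w∈² d≡0 2∈w ∷ 2∈w ∷ []) , from d≡0 })
  where
  |w|≡n = proj₁ (∈-words⁻ {n} w∈)
  w∈²   = proj₂ (∈-words⁻ {n} w∈)
  open Equivalence (InC[1]⇔depth≡0 w∈²)
  #2≤n/2 : depth 0 w ≡ 0 → count (1 <?_) w ≤ n / 2
  #2≤n/2 d≡0 = m+m≤n⇒m≤n/2 (subst (count (1 <?_) w + count (1 <?_) w ≤_) |w|≡n (depth≡0⇒length-bound w w∈² d≡0))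

b-two : ∀ n → b n 2 ≡ n C (n / 2) ∸ 1
b-two n = begin
  b n 2           ≡⟨ m+n∸n≡m (b n 2) 1 ⟨
  b n 2 + 1 ∸ 1   ≡⟨ cong (_∸ 1) b+1≡C ⟩
  n C (n / 2) ∸ 1 ∎
  where
  open ≡-Reasoning
  ws = words n 2
  Matched? = λ w → depth 0 w ≟ 0 ×-dec count (1 <?_) w ≤? n / 2
  only-ones : count (Matched? ∩? ∁? (2 ∈?_)) ws ≡ 1
  only-ones = unique-witness⇒count≡1 _ (words-unique n 2) (ones∈words n (s≤s z≤n))
    ((depth-ones n , subst (_≤ n / 2) (sym (count[1<]-ones n)) z≤n) , 2∉ones n)
    λ v∈ (_ , 2∉v) → without-2⇒ones v∈ 2∉v
  b+1≡C : b n 2 + 1 ≡ n C (n / 2)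
  b+1≡C = begin
    b n 2 + 1
      ≡⟨ cong₂ _+_ (count-cong _ _ ws (Equivalence.to ∘ packed₂∧commutes⇔ {n}) (Equivalence.from ∘ packed₂∧commutes⇔ {n}))
                   (sym only-ones) ⟩
    count (Matched? ∩? (2 ∈?_)) ws + count (Matched? ∩? ∁? (2 ∈?_)) ws
      ≡⟨ count-split Matched? (2 ∈?_) ws ⟨
    #matched n 0 (n / 2)
      ≡⟨ #matched≡C n 0 (n / 2) (n/2+n/2≤n n) ⟩
    n C (n / 2)
      ∎

theorem4p5 : (n : ℕ) → 1 ≤ n →
    ((k : ℕ) → 1 ≤ k → k ≤ n → 1 ≤ b n k)
    × b n 1 ≡ 1
    × (2 ≤ n → b n 2 ≡ (n C (n / 2)) ∸ 1)
    × b n n ≡ 1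
theorem4p5 (suc m) _ = (λ _ → b-positive) , b-one m , (λ _ → b-two (suc m)) , b-diagonal m
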